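{- If $G=K_{1,n}$ is the star with $n\ge 3$ leaves, then $\mathrm{fpt}(G)=2$.
   Context: Zero forcing: given a set $B\subseteq V(G)$ of initially blue vertices (all others white), the color change rule allows a blue vertex $b$ to turn a white vertex $w$ blue if $w$ is the unique white neighbor of $b$. $B$ is a zero forcing set if repeated application eventually turns all of $V(G)$ blue. Propagation: set $B^{[0]}=B$ and for $i\ge1$ let $B^{(i)}$ be the set of vertices $u\notin B^{[i-1]}$ such that some $v\in B^{[i-1]}$ has $u$ as its unique neighbor outside $B^{[i-1]}$, and $B^{[i]}=B^{[i-1]}\cup B^{(i)}$; $\mathrm{pt}(G,B)$ is the least $k$ with $B^{[k]}=V(G)$. A set $B$ with $|B|=m\ge1$ is a fault tolerant zero forcing set if every $(m-1)$-subset of $B$ is a zero forcing set; $\mathrm{Z}_t(G)$ is the minimum size of such a set, and a fault tolerant zero forcing set of that size is called minimum. For a fault tolerant zero forcing set $B$, $\mathrm{fpt}(G,B)=\max_{b\in B}\mathrm{pt}(G,B\setminus\{b\})$, and $\mathrm{fpt}(G)=\min\{\mathrm{fpt}(G,B): B \text{ a minimum fault tolerant zero forcing set of } G\}$. -}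

module Defs where

open import Data.Nat using (ℕ; zero; suc; _≤_; _<_)
open import Data.Bool using (Bool; true; false; _∧_; _∨_; not)
open import Data.Fin using (Fin; zero; suc)
open import Data.Fin.Properties using (_≟_)
open import Data.Fin.Subset using (Subset; _∈_; _-_; ∣_∣; ⊤)
open import Data.Vec using (lookup; tabulate)
open import Data.List using (List; allFin)
open import Data.Bool.ListAction using (any; all)
open import Data.Product using (Σ; _×_; ∃; _,_)
open import Relation.Nullary.Decidable using (⌊_⌋)
open import Relation.Binary.PropositionalEquality using (_≡_; _≢_)

record Graph (N : ℕ) : Set where
  field
    adj     : Fin N → Fin N → Bool
    sym     : ∀ u v → adj u v ≡ adj v u
    irrefl  : ∀ u → adj u u ≡ false
open Graph public

-- The star K_{1,n}: centre is vertex zero, leaves are suc i (i : Fin n).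
starAdj : ∀ {n} → Fin (suc n) → Fin (suc n) → Bool
starAdj zero    zero    = false
starAdj zero    (suc _) = true
starAdj (suc _) zero    = true
starAdj (suc _) (suc _) = false

starSym : ∀ {n} (u v : Fin (suc n)) → starAdj u v ≡ starAdj v u
starSym zero    zero    = _≡_.refl
starSym zero    (suc _) = _≡_.refl
starSym (suc _) zero    = _≡_.refl
starSym (suc _) (suc _) = _≡_.refl

starIrr : ∀ {n} (u : Fin (suc n)) → starAdj u u ≡ false
starIrr zero    = _≡_.refl
starIrr (suc _) = _≡_.refl

star : (n : ℕ) → Graph (suc n)
star n = record { adj = starAdj ; sym = starSym ; irrefl = starIrr }

module _ {N : ℕ} (G : Graph N) where

  private
    vs : List (Fin N)
    vs = allFin N

  -- u is in B^{(i)} w.r.t. current blue set B: u ∉ B and some v ∈ B has u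
  -- as its unique neighbour outside B.
  forced : Subset N → Fin N → Bool
  forced B u =
    not (lookup B u) ∧
    any (λ v → lookup B v ∧ adj G v u ∧
               all (λ w → not (adj G v w ∧ not (lookup B w)) ∨ ⌊ w ≟ u ⌋) vs)
        vs

  step : Subset N → Subset N
  step B = tabulate (λ u → lookup B u ∨ forced B u)

  blueAfter : ℕ → Subset N → Subset N
  blueAfter zero    B = B
  blueAfter (suc k) B = step (blueAfter k B)

  PropTime : Subset N → ℕ → Set
  PropTime B k = blueAfter k B ≡ ⊤ × (∀ j → j < k → blueAfter j B ≢ ⊤)

  IsZeroForcing : Subset N → Set
  IsZeroForcing B = ∃ λ k → blueAfter k B ≡ ⊤

  -- fault tolerant zero forcing set: |B| ≥ 1 and every (|B|-1)-subset of B
  -- (i.e. every B ∖ {b} with b ∈ B) is zero forcing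
  IsFTZF : Subset N → Set
  IsFTZF B = 1 ≤ ∣ B ∣ × (∀ b → b ∈ B → IsZeroForcing (B - b))

  IsMinFTZF : Subset N → Set
  IsMinFTZF B = IsFTZF B × (∀ B′ → IsFTZF B′ → ∣ B ∣ ≤ ∣ B′ ∣)

  FaultPropTime : Subset N → ℕ → Set
  FaultPropTime B k =
    (∀ b → b ∈ B → ∃ λ j → PropTime (B - b) j × j ≤ k) ×
    (∃ λ b → b ∈ B × PropTime (B - b) k)

  FPT : ℕ → Set
  FPT k =
    (∃ λ B → IsMinFTZF B × FaultPropTime B k) ×
    (∀ B k′ → IsMinFTZF B → FaultPropTime B k′ → k ≤ k′)

{-# OPTIONS --safe #-}
-- A leaf of K_{1,n} can only be forced by the centre, and the centre forces
-- nothing while two leaves are white; so a zero forcing set misses at most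
-- one leaf.  Since this must survive the removal of any element, a fault
-- tolerant zero forcing set contains every leaf, and the leaves alone form
-- the unique minimum one.  With one leaf removed, another leaf forces the
-- centre in the first round and the centre forces the missing leaf in the
-- second, which cannot happen earlier because the centre starts white.
module Submission where

open import Defs hiding (sym)
open import Data.Nat using (ℕ; zero; suc; _≤_; z≤n; s≤s)
open import Data.Nat.Properties
  using (≮⇒≥; ≤-antisym; ≤-trans; ≤-refl; ≤-reflexive; <⇒≱; n≤1+n; 1+n≰n; module ≤-Reasoning)
open import Data.Bool using (true; false; T; _∧_; _∨_; not)
open import Data.Bool.Properties using (T-≡; T-∧; T-∨)
open import Data.Fin using (Fin; zero; suc; punchIn)
open import Data.Fin.Properties using (_≟_; suc-injective; punchInᵢ≢i)
open import Data.Fin.Subset using (Subset; inside; outside; _∈_; _∉_; _⊆_; _-_; ∣_∣; ⊤; ⁅_⁆; Nonempty)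
open import Data.Fin.Subset.Properties
  using (_∈?_; ∈⊤; ⊆⊤; ⊆-antisym; ∣⊤∣≡n; p⊆q⇒∣p∣≤∣q∣; p─q⊆p; x∈p∧x≢y⇒x∈p-y)
open import Data.Vec using (_∷_; here; there; lookup)
open import Data.Vec.Properties using ([]=⇒lookup; lookup⇒[]=; lookup∘tabulate)
open import Data.List using (allFin)
open import Data.List.Membership.Propositional.Properties using (∈-allFin)
import Data.List.Relation.Unary.All as All
import Data.List.Relation.Unary.All.Properties as All
import Data.List.Relation.Unary.Any as Any
import Data.List.Relation.Unary.Any.Properties as Any
open import Data.Product using (∃; _×_; _,_; proj₁; proj₂)
open import Data.Sum using (_⊎_; inj₁; inj₂; [_,_]′)
open import Data.Empty using (⊥-elim)
open import Function using (_∘_; _⇔_; mk⇔; Equivalence)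
open import Relation.Nullary using (¬_; yes; no; contradiction)
open import Relation.Nullary.Decidable using (⌊_⌋; toWitness; fromWitness; decidable-stable)
open import Relation.Binary.PropositionalEquality using (_≡_; _≢_; refl; sym; cong; subst)

open Equivalence using (to; from)

variable
  m N : ℕ
  G : Graph N
  C : Subset N
  u v : Fin N
  j k : ℕ

∈⇔T-lookup : (u ∈ C) ⇔ T (lookup C u)
∈⇔T-lookup {u = u} {C = C} =
  mk⇔ (from T-≡ ∘ []=⇒lookup) (lookup⇒[]= u C ∘ to T-≡)

∉⇒T-not-lookup : u ∉ C → T (not (lookup C u))
∉⇒T-not-lookup {u = u} {C = C} u∉C with lookup C u in eq
... | true  = u∉C (from ∈⇔T-lookup (from T-≡ eq))
... | false = _

x∉p-x : (p : Subset m) (x : Fin m) → x ∉ p - x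
x∉p-x (_ ∷ p) (suc x) (there x∈p-x) = x∉p-x p x x∈p-x

1≤∣p∣⇒nonempty : (p : Subset m) → 1 ≤ ∣ p ∣ → Nonempty p
1≤∣p∣⇒nonempty (inside  ∷ p) _ = zero , here
1≤∣p∣⇒nonempty (outside ∷ p) h with 1≤∣p∣⇒nonempty p h
... | x , x∈p = suc x , there x∈p

p≡⊤⇒x∈p : C ≡ ⊤ → u ∈ C
p≡⊤⇒x∈p refl = ∈⊤

sole-white-neighbour⇔ : ∀ a b {w u : Fin N} →
  T (not (a ∧ not b) ∨ ⌊ w ≟ u ⌋) ⇔ (T a → ¬ T b → w ≡ u)
sole-white-neighbour⇔ false _    = mk⇔ (λ _ ()) _
sole-white-neighbour⇔ true  true = mk⇔ (λ _ _ ¬b → ⊥-elim (¬b _)) _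
sole-white-neighbour⇔ true  false =
  mk⇔ (λ w≡u _ _ → toWitness w≡u) (λ f → fromWitness (f _ (λ ())))

Forces : Graph N → Subset N → Fin N → Fin N → Set
Forces G C v u = v ∈ C × T (adj G v u) × (∀ w → T (adj G v w) → w ∉ C → w ≡ u)

module _ {N : ℕ} {G : Graph N} {C : Subset N} where

  forced⇒forces : T (forced G C u) → ∃ λ v → Forces G C v u
  forced⇒forces {u} p with Any.satisfied (Any.any⁻ _ (allFin N) (proj₂ (to T-∧ p)))
  ... | v , q with to T-∧ q
  ... | v∈C , r with to T-∧ r
  ... | adj-vu , sole =
    v , from ∈⇔T-lookup v∈C , adj-vu ,
    λ w adj-vw w∉C → to (sole-white-neighbour⇔ (adj G v w) (lookup C w))
                        (All.lookup (All.all⁺ _ (allFin N) sole) (∈-allFin w))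
                        adj-vw (w∉C ∘ from ∈⇔T-lookup)

  forces⇒forced : u ∉ C → Forces G C v u → T (forced G C u)
  forces⇒forced {u} {v} u∉C (v∈C , adj-vu , sole) =
    from T-∧ (∉⇒T-not-lookup u∉C ,
      Any.any⁺ _ (Any.tabulate⁺ v
        (from T-∧ (to ∈⇔T-lookup v∈C , from T-∧ (adj-vu ,
          All.all⁻ _ (All.tabulate⁺ λ w →
            from (sole-white-neighbour⇔ (adj G v w) (lookup C w))
                 (λ adj-vw ¬w∈C → sole w adj-vw (¬w∈C ∘ to ∈⇔T-lookup))))))))

  ∈-step⁺ : u ∈ C ⊎ T (forced G C u) → u ∈ step G C
  ∈-step⁺ {u} h = from ∈⇔T-lookup
    (subst T (sym (lookup∘tabulate (λ x → lookup C x ∨ forced G C x) u))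
      (from T-∨ ([ inj₁ ∘ to ∈⇔T-lookup , inj₂ ]′ h)))

  ∈-step⁻ : u ∈ step G C → u ∈ C ⊎ T (forced G C u)
  ∈-step⁻ {u} h =
    [ inj₁ ∘ from ∈⇔T-lookup , inj₂ ]′
      (to T-∨ (subst T (lookup∘tabulate (λ x → lookup C x ∨ forced G C x) u)
        (to ∈⇔T-lookup h)))

  ⊆-step : C ⊆ step G C
  ⊆-step = ∈-step⁺ ∘ inj₁

  forces⇒∈-step : u ∉ C → Forces G C v u → u ∈ step G C
  forces⇒∈-step u∉C = ∈-step⁺ ∘ inj₂ ∘ forces⇒forced u∉C

  unforced⇒∉-step : u ∉ C → (∀ v → ¬ Forces G C v u) → u ∉ step G C
  unforced⇒∉-step u∉C unforced =
    [ u∉C , (λ f → let v , v→u = forced⇒forces f in unforced v v→u) ]′ ∘ ∈-step⁻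

propTime-unique : PropTime G C j → PropTime G C k → j ≡ k
propTime-unique {j = j} {k = k} (done-j , early-j) (done-k , early-k) =
  ≤-antisym (≮⇒≥ λ k<j → early-j k k<j done-k) (≮⇒≥ λ j<k → early-k j j<k done-j)

faultPropTime-unique : ∀ {B} → FaultPropTime G B j → FaultPropTime G B k → j ≡ k
faultPropTime-unique {G = G} {B = B} (bounded-j , b , b∈B , pt-b) (bounded-k , c , c∈B , pt-c) =
  ≤-antisym (attained≤bound bounded-k b∈B pt-b) (attained≤bound bounded-j c∈B pt-c)
  where
  attained≤bound : ∀ {b i k} → (∀ b → b ∈ B → ∃ λ j → PropTime G (B - b) j × j ≤ k) →
                   b ∈ B → PropTime G (B - b) i → i ≤ k
  attained≤bound bounded b∈B pt with bounded _ b∈B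
  ... | _ , pt′ , i′≤k = subst (_≤ _) (propTime-unique pt′ pt) i′≤k

∃-distinct : 2 ≤ m → (i : Fin m) → ∃ λ j → j ≢ i
∃-distinct (s≤s (s≤s _)) i = punchIn i zero , punchInᵢ≢i i zero

module _ {n : ℕ} {C : Subset (suc n)} where

  leaf-forcer≡centre : ∀ {v i} → Forces (star n) C v (suc i) → v ≡ zero
  leaf-forcer≡centre {zero}  _ = refl
  leaf-forcer≡centre {suc _} (_ , () , _)

  leaf-white-while-centre-white : ∀ {i} → zero ∉ C → suc i ∉ C → suc i ∉ step (star n) C
  leaf-white-while-centre-white centre∉C leaf∉C =
    unforced⇒∉-step {G = star n} leaf∉C λ v v→leaf →
      centre∉C (subst (_∈ C) (leaf-forcer≡centre v→leaf) (proj₁ v→leaf))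

  leaf-white-beside-white-leaf : ∀ {i j} → suc i ∉ C → suc j ∉ C → j ≢ i → suc i ∉ step (star n) C
  leaf-white-beside-white-leaf {i} {j} i∉C j∉C j≢i =
    unforced⇒∉-step {G = star n} i∉C λ v v→i → centre-cannot-force (leaf-forcer≡centre v→i) v→i
    where
    centre-cannot-force : ∀ {v} → v ≡ zero → ¬ Forces (star n) C v (suc i)
    centre-cannot-force refl (_ , _ , sole) = j≢i (suc-injective (sole (suc j) _ j∉C))

  propTime≥2 : ∀ {i k} → zero ∉ C → suc i ∉ C → blueAfter (star n) k C ≡ ⊤ → 2 ≤ k
  propTime≥2 {k = zero}        _        leaf∉C done = contradiction (p≡⊤⇒x∈p done) leaf∉C
  propTime≥2 {k = suc zero}    centre∉C leaf∉C done =
    contradiction (p≡⊤⇒x∈p done) (leaf-white-while-centre-white centre∉C leaf∉C)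
  propTime≥2 {k = suc (suc _)} _        _      _    = s≤s (s≤s z≤n)

white-leaves-stay-white : ∀ {n} {C : Subset (suc n)} {i j} → suc i ∉ C → suc j ∉ C → j ≢ i →
  ∀ k → suc i ∉ blueAfter (star n) k C × suc j ∉ blueAfter (star n) k C
white-leaves-stay-white i∉C j∉C j≢i zero = i∉C , j∉C
white-leaves-stay-white i∉C j∉C j≢i (suc k) with white-leaves-stay-white i∉C j∉C j≢i k
... | i∉ , j∉ = leaf-white-beside-white-leaf i∉ j∉ j≢i , leaf-white-beside-white-leaf j∉ i∉ (j≢i ∘ sym)

zeroForcing-misses-one-leaf : ∀ {n} {C : Subset (suc n)} {i j} →
  IsZeroForcing (star n) C → suc i ∉ C → j ≢ i → suc j ∈ C
zeroForcing-misses-one-leaf {C = C} {j = j} (k , done) i∉C j≢i =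
  decidable-stable (suc j ∈? C) λ j∉C →
    proj₁ (white-leaves-stay-white i∉C j∉C j≢i k) (p≡⊤⇒x∈p done)

module _ {n : ℕ} where

  leaves : Subset (suc n)
  leaves = outside ∷ ⊤

  leaves-minus-leaf-propTime : 2 ≤ n → (i : Fin n) → PropTime (star n) (leaves - suc i) 2
  leaves-minus-leaf-propTime 2≤n i =
    ⊆-antisym ⊆⊤ (λ {x} _ → blue-after-two x) ,
    λ k k<2 done → <⇒≱ k<2 (propTime≥2 centre∉C₀ leaf∉C₀ done)
    where
    C₀ C₁ : Subset (suc n)
    C₀ = leaves - suc i
    C₁ = step (star n) C₀

    centre∉C₀ : zero ∉ C₀
    centre∉C₀ = (λ ()) ∘ p─q⊆p leaves ⁅ suc i ⁆

    leaf∉C₀ : suc i ∉ C₀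
    leaf∉C₀ = x∉p-x leaves (suc i)

    other∈C₀ : ∀ {j} → j ≢ i → suc j ∈ C₀
    other∈C₀ j≢i = x∈p∧x≢y⇒x∈p-y (there ∈⊤) (j≢i ∘ suc-injective)

    centre∈C₁ : zero ∈ C₁
    centre∈C₁ with ∃-distinct 2≤n i
    ... | j , j≢i = forces⇒∈-step {G = star n} centre∉C₀ (other∈C₀ j≢i , _ , λ { zero _ _ → refl })

    blue-after-two : ∀ x → x ∈ step (star n) C₁
    blue-after-two zero = ⊆-step {G = star n} centre∈C₁
    blue-after-two (suc j) with j ≟ i
    ... | no j≢i = ⊆-step {G = star n} (⊆-step {G = star n} (other∈C₀ j≢i))
    ... | yes refl =
      forces⇒∈-step {G = star n} (leaf-white-while-centre-white centre∉C₀ leaf∉C₀) (centre∈C₁ , _ , sole)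
      where
      sole : ∀ w → T (starAdj zero w) → w ∉ C₁ → w ≡ suc i
      sole (suc k) _ k∉C₁ =
        cong suc (decidable-stable (k ≟ i) λ k≢i → k∉C₁ (⊆-step {G = star n} (other∈C₀ k≢i)))

  ftzf-missing-leaf⇒only-centre : ∀ {B i b} → IsFTZF (star n) B → suc i ∉ B → b ∈ B → b ≡ zero
  ftzf-missing-leaf⇒only-centre {b = zero}  _        _   _   = refl
  ftzf-missing-leaf⇒only-centre {B} {i} {suc j} (_ , zf) i∉B j∈B =
    contradiction (zeroForcing-misses-one-leaf (zf (suc j) j∈B) (i∉B ∘ p─q⊆p B ⁅ suc j ⁆) j≢i)
                  (x∉p-x B (suc j))
    where
    j≢i : j ≢ i
    j≢i refl = i∉B j∈B

  ftzf-contains-leaf : 2 ≤ n → ∀ {B i} → IsFTZF (star n) B → suc i ∈ B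
  ftzf-contains-leaf 2≤n {B} {i} ftzf@(size≥1 , zf) = decidable-stable (suc i ∈? B) λ i∉B →
    let b , b∈B   = 1≤∣p∣⇒nonempty B size≥1
        j , j≢i   = ∃-distinct 2≤n i
        centre∈B  = subst (_∈ B) (ftzf-missing-leaf⇒only-centre ftzf i∉B b∈B) b∈B
        j∈B       = p─q⊆p B ⁅ zero ⁆
                      (zeroForcing-misses-one-leaf (zf zero centre∈B) (i∉B ∘ p─q⊆p B ⁅ zero ⁆) j≢i)
    in contradiction (ftzf-missing-leaf⇒only-centre ftzf i∉B j∈B) λ ()

  leaves⊆ftzf : 2 ≤ n → ∀ {B} → IsFTZF (star n) B → leaves ⊆ B
  leaves⊆ftzf 2≤n ftzf {suc _} _ = ftzf-contains-leaf 2≤n ftzf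

  leaves-ftzf : 2 ≤ n → IsFTZF (star n) leaves
  leaves-ftzf 2≤n =
    subst (1 ≤_) (sym (∣⊤∣≡n n)) (≤-trans (s≤s z≤n) 2≤n) ,
    λ { (suc i) _ → 2 , proj₁ (leaves-minus-leaf-propTime 2≤n i) }

  leaves-minimum : 2 ≤ n → IsMinFTZF (star n) leaves
  leaves-minimum 2≤n = leaves-ftzf 2≤n , λ _ ftzf → p⊆q⇒∣p∣≤∣q∣ (leaves⊆ftzf 2≤n ftzf)

  minimum≡leaves : 2 ≤ n → ∀ {B} → IsMinFTZF (star n) B → B ≡ leaves
  minimum≡leaves 2≤n {B} (ftzf , minimal) = ⊆-antisym B⊆leaves (leaves⊆ftzf 2≤n ftzf)
    where
    centre∉B : zero ∉ B
    centre∉B centre∈B = 1+n≰n (begin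
      suc n         ≡⟨ ∣⊤∣≡n (suc n) ⟨
      ∣ ⊤ {suc n} ∣ ≤⟨ p⊆q⇒∣p∣≤∣q∣ ⊤⊆B ⟩
      ∣ B ∣         ≤⟨ minimal leaves (leaves-ftzf 2≤n) ⟩
      ∣ leaves ∣    ≡⟨ ∣⊤∣≡n n ⟩
      n             ∎)
      where
      open ≤-Reasoning
      ⊤⊆B : ⊤ ⊆ B
      ⊤⊆B {zero}  _ = centre∈B
      ⊤⊆B {suc _} _ = leaves⊆ftzf 2≤n ftzf (there ∈⊤)

    B⊆leaves : B ⊆ leaves
    B⊆leaves {zero}  centre∈B = contradiction centre∈B centre∉B
    B⊆leaves {suc _} _        = there ∈⊤

  leaves-faultPropTime : 2 ≤ n → FaultPropTime (star n) leaves 2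
  leaves-faultPropTime 2≤n@(s≤s _) =
    (λ { (suc i) _ → 2 , leaves-minus-leaf-propTime 2≤n i , ≤-refl }) ,
    suc zero , there ∈⊤ , leaves-minus-leaf-propTime 2≤n zero

proposition5p9 : (n : ℕ) → 3 ≤ n → FPT (star n) 2
proposition5p9 n 3≤n = (leaves , leaves-minimum 2≤n , leaves-faultPropTime 2≤n) , fpt≥2
  where
  2≤n : 2 ≤ n
  2≤n = ≤-trans (n≤1+n 2) 3≤n

  fpt≥2 : ∀ B k → IsMinFTZF (star n) B → FaultPropTime (star n) B k → 2 ≤ k
  fpt≥2 _ _ minimum fpt with refl ← minimum≡leaves 2≤n minimum =
    ≤-reflexive (faultPropTime-unique (leaves-faultPropTime 2≤n) fpt)
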